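{- For every context $\Gamma$ and all propositions $\varphi,\psi$: $\Gamma\vdash \varphi\to\psi\ \mathit{just\ true}$ is derivable if and only if $\Gamma\vdash \varphi\to\mathsf{E}\psi\ \mathit{true}$ is derivable.
   Context: Propositions are generated by $\varphi ::= p \mid \varphi\to\psi \mid \mathsf{E}\varphi$, where $p$ ranges over atomic propositions and $\mathsf{E}$ is a unary "existence" modality. A context $\Gamma$ is a finite list $\varphi_1\ \mathit{true},\dots,\varphi_n\ \mathit{true}$ (only hypotheses of the form $\varphi\ \mathit{true}$ occur in contexts). There are two judgment forms, $\Gamma\vdash\varphi\ \mathit{true}$ and $\Gamma\vdash\varphi\ \mathit{just\ true}$, whose derivability is defined inductively by the following rules; in each schema marked with $\star$, the symbol $\star$ stands uniformly (all occurrences the same) for either $\mathit{true}$ or $\mathit{just\ true}$: (HYP) $\Gamma,\varphi\ \mathit{true}\vdash\varphi\ \mathit{true}$. (JUST) from $\Gamma\vdash\varphi\ \mathit{true}$ infer $\Gamma\vdash\varphi\ \mathit{just\ true}$. ($\to$I$\star$) from $\Gamma,\varphi\ \mathit{true}\vdash\psi\ \star$ infer $\Gamma\vdash\varphi\to\psi\ \star$. ($\to$E$\star$) from $\Gamma\vdash\varphi\to\psi\ \star$ and $\Gamma\vdash\varphi\ \mathit{true}$ infer $\Gamma\vdash\psi\ \star$. ($\mathsf{E}$I$\star$) from $\Gamma\vdash\varphi\ \mathit{just\ true}$ infer $\Gamma\vdash\mathsf{E}\varphi\ \star$. ($\mathsf{E}$E$\star$) from $\Gamma\vdash\mathsf{E}\varphi\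 \star$ and $\Gamma,\varphi\ \mathit{true}\vdash\gamma\ \mathit{just\ true}$ infer $\Gamma\vdash\gamma\ \mathit{just\ true}$. There are no other rules. -}

module Defs where

open import Data.Nat using (ℕ)
open import Data.List using (List; _∷_)
open import Data.List.Membership.Propositional using (_∈_)

data Prop : Set where
  atom : ℕ → Prop
  _⇒_  : Prop → Prop → Prop
  E    : Prop → Prop

infixr 6 _⇒_

-- Contexts: finite lists of hypotheses "φ true".
-- Convention: the context  Γ , φ true  is represented as  φ ∷ Γ
-- (the most recently added hypothesis is at the head of the list).
Ctx : Set
Ctx = List Prop

_,,_ : Ctx → Prop → Ctx
Γ ,, φ = φ ∷ Γ

infixl 5 _,,_

data Mode : Set where
  true justTrue : Mode

-- HYP is read with the standard convention that Γ, φ true ⊢ φ true holds with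
-- φ anywhere in the context (contexts are finite lists up to exchange/weakening).
data _⊢_∶_ : Ctx → Prop → Mode → Set where
  hyp   : ∀ {Γ φ} → φ ∈ Γ → Γ ⊢ φ ∶ true
  just  : ∀ {Γ φ} → Γ ⊢ φ ∶ true → Γ ⊢ φ ∶ justTrue
  ⇒I    : ∀ {Γ φ ψ m} → (Γ ,, φ) ⊢ ψ ∶ m → Γ ⊢ (φ ⇒ ψ) ∶ m
  ⇒E    : ∀ {Γ φ ψ m} → Γ ⊢ (φ ⇒ ψ) ∶ m → Γ ⊢ φ ∶ true → Γ ⊢ ψ ∶ m
  EI    : ∀ {Γ φ m} → Γ ⊢ φ ∶ justTrue → Γ ⊢ E φ ∶ m
  EE    : ∀ {Γ φ γ m} → Γ ⊢ E φ ∶ m → (Γ ,, φ) ⊢ γ ∶ justTrue → Γ ⊢ γ ∶ justTrue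

infix 4 _⊢_∶_

{-# OPTIONS --safe #-}
module Submission where

open import Defs
open import Data.List.Relation.Binary.Subset.Propositional using (_⊆_)
open import Data.List.Relation.Binary.Subset.Propositional.Properties using (∷⁺ʳ; xs⊆x∷xs)
open import Data.List.Relation.Unary.Any using (here)
open import Function.Bundles using (_⇔_; mk⇔)
open import Function.Construct.Symmetry using (⇔-sym)
open import Function.Related.Propositional using (module EquationalReasoning)
open import Relation.Binary.PropositionalEquality using (refl)

-- Both sides reduce to judgments in the context Γ, φ true: ⇒I is invertible in
-- either mode, and "ψ just true" and "E ψ true" are interderivable (by EI, and
-- conversely by EE with the hypothesis ψ true as continuation).

weaken-⊆ : ∀ {Γ Δ φ m} → Γ ⊆ Δ → Γ ⊢ φ ∶ m → Δ ⊢ φ ∶ m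
weaken-⊆ Γ⊆Δ (hyp φ∈Γ) = hyp (Γ⊆Δ φ∈Γ)
weaken-⊆ Γ⊆Δ (just d)  = just (weaken-⊆ Γ⊆Δ d)
weaken-⊆ Γ⊆Δ (⇒I d)    = ⇒I (weaken-⊆ (∷⁺ʳ _ Γ⊆Δ) d)
weaken-⊆ Γ⊆Δ (⇒E d e)  = ⇒E (weaken-⊆ Γ⊆Δ d) (weaken-⊆ Γ⊆Δ e)
weaken-⊆ Γ⊆Δ (EI d)    = EI (weaken-⊆ Γ⊆Δ d)
weaken-⊆ Γ⊆Δ (EE d e)  = EE (weaken-⊆ Γ⊆Δ d) (weaken-⊆ (∷⁺ʳ _ Γ⊆Δ) e)

weaken : ∀ {Γ φ ψ m} → Γ ⊢ φ ∶ m → Γ ,, ψ ⊢ φ ∶ m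
weaken {Γ} {ψ = ψ} = weaken-⊆ (xs⊆x∷xs Γ ψ)

⇒I⁻¹ : ∀ {Γ φ ψ m} → Γ ⊢ φ ⇒ ψ ∶ m → Γ ,, φ ⊢ ψ ∶ m
⇒I⁻¹ d = ⇒E (weaken d) (hyp (here refl))

⇒-invertible : ∀ {Γ φ ψ m} → (Γ ⊢ φ ⇒ ψ ∶ m) ⇔ (Γ ,, φ ⊢ ψ ∶ m)
⇒-invertible = mk⇔ ⇒I⁻¹ ⇒I

E-elim-justTrue : ∀ {Γ φ m} → Γ ⊢ E φ ∶ m → Γ ⊢ φ ∶ justTrue
E-elim-justTrue d = EE d (just (hyp (here refl)))

justTrue⇔E-true : ∀ {Γ φ} → (Γ ⊢ φ ∶ justTrue) ⇔ (Γ ⊢ E φ ∶ true)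
justTrue⇔E-true = mk⇔ EI E-elim-justTrue

proposition1 : ∀ (Γ : Ctx) (φ ψ : Prop) → (Γ ⊢ φ ⇒ ψ ∶ justTrue) ⇔ (Γ ⊢ φ ⇒ E ψ ∶ true)
proposition1 Γ φ ψ = begin
  Γ ⊢ φ ⇒ ψ ∶ justTrue   ∼⟨ ⇒-invertible ⟩
  Γ ,, φ ⊢ ψ ∶ justTrue  ∼⟨ justTrue⇔E-true ⟩
  Γ ,, φ ⊢ E ψ ∶ true    ∼⟨ ⇔-sym ⇒-invertible ⟩
  Γ ⊢ φ ⇒ E ψ ∶ true     ∎
  where open EquationalReasoning
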